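{- If $G$ is a dually chordal graph, then $\operatorname{pg}(G)\le 1$.
   Context: Graphs are finite, connected, unweighted, undirected and simple; $d_G$ is shortest-path distance; $\Pr(x,S)=\{u\in S\mid d_G(u,x)=\min_{w\in S}d_G(w,x)\}$. A graph is dually chordal if it is the intersection graph of the maximal cliques of a chordal graph (one in which every cycle of length at least four has a chord). Projection gap: for an integer $\gamma\ge0$, $G$ has projection gap at most $\gamma$ if for every shortest path $P=(v_0,\dots,v_l)$ (with $d_G(v_0,v_i)=i$), every vertex $x$ and every $v_i,v_k\in\Pr(x,P)$ with $i<k$, $d_G(v_i,v_k)>\gamma+1$ implies there is $v_j\in\Pr(x,P)$ with $i<j<k$; $\operatorname{pg}(G)$ is the least such $\gamma$. -}

module Defs where

open import Data.Nat using (ℕ; zero; suc; _+_; _∸_; _≤_; _<_)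
open import Data.Fin using (Fin; toℕ)
open import Data.Fin.Subset using (Subset; _∈_; _⊆_)
open import Data.Product using (Σ; ∃; _×_; _,_)
open import Data.Sum using (_⊎_)
open import Relation.Nullary using (¬_)
open import Relation.Binary.PropositionalEquality using (_≡_; _≢_)

record Graph : Set₁ where
  field
    n     : ℕ
    Adj   : Fin n → Fin n → Set
    sym   : ∀ {u v} → Adj u v → Adj v u
    irrefl : ∀ {u} → ¬ Adj u u

open Graph public

data Walk (G : Graph) : Fin (n G) → Fin (n G) → ℕ → Set where
  nil  : ∀ {u} → Walk G u u 0
  cons : ∀ {u w v k} → Adj G u w → Walk G w v k → Walk G u v (suc k)

Connected : Graph → Set
Connected G = ∀ (u v : Fin (n G)) → ∃ λ k → Walk G u v k

IsDist : (G : Graph) → Fin (n G) → Fin (n G) → ℕ → Set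
IsDist G u v k = Walk G u v k × (∀ m → Walk G u v m → k ≤ m)

IsShortestPath : (G : Graph) (l : ℕ) → (Fin (suc l) → Fin (n G)) → Set
IsShortestPath G l P =
  (∀ (i j : Fin (suc l)) → toℕ j ≡ suc (toℕ i) → Adj G (P i) (P j))
  × (∀ (i : Fin (suc l)) → IsDist G (P Data.Fin.zero) (P i) (toℕ i))

InPr : (G : Graph) (l : ℕ) → (Fin (suc l) → Fin (n G)) → Fin (n G)
     → Fin (suc l) → Set
InPr G l P x i =
  ∃ λ k → IsDist G (P i) x k × (∀ (j : Fin (suc l)) k' → IsDist G (P j) x k' → k ≤ k')

HasProjectionGapAtMost : Graph → ℕ → Set
HasProjectionGapAtMost G γ =
  ∀ (l : ℕ) (P : Fin (suc l) → Fin (n G)) → IsShortestPath G l P →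
  ∀ (x : Fin (n G)) (i k : Fin (suc l)) → toℕ i < toℕ k →
  InPr G l P x i → InPr G l P x k →
  ∀ (d : ℕ) → IsDist G (P i) (P k) d → suc γ < d →
  ∃ λ (j : Fin (suc l)) → toℕ i < toℕ j × toℕ j < toℕ k × InPr G l P x j

CycNext : (k : ℕ) → Fin k → Fin k → Set
CycNext k i j = toℕ j ≡ suc (toℕ i) ⊎ (suc (toℕ i) ≡ k × toℕ j ≡ 0)

IsCycle : (G : Graph) (k : ℕ) → (Fin k → Fin (n G)) → Set
IsCycle G k c =
  (∀ i j → c i ≡ c j → i ≡ j) × (∀ i j → CycNext k i j → Adj G (c i) (c j))

HasChord : (G : Graph) (k : ℕ) → (Fin k → Fin (n G)) → Set
HasChord G k c =
  ∃ λ i → ∃ λ j → i ≢ j × ¬ CycNext k i j × ¬ CycNext k j i × Adj G (c i) (c j)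

Chordal : Graph → Set
Chordal G = ∀ (k : ℕ) → 4 ≤ k → (c : Fin k → Fin (n G)) → IsCycle G k c → HasChord G k c

IsClique : (H : Graph) → Subset (n H) → Set
IsClique H C = ∀ a b → a ∈ C → b ∈ C → a ≢ b → Adj H a b

IsMaximalClique : (H : Graph) → Subset (n H) → Set
IsMaximalClique H C = IsClique H C × (∀ C' → IsClique H C' → C ⊆ C' → C' ⊆ C)

IsCliqueGraphOf : (G H : Graph) → Set
IsCliqueGraphOf G H =
  Σ (Fin (n G) → Subset (n H)) λ f →
    (∀ u → IsMaximalClique H (f u))
  × (∀ u v → f u ≡ f v → u ≡ v)
  × (∀ C → IsMaximalClique H C → ∃ λ u → f u ≡ C)
  × (∀ u v → u ≢ v → (Adj G u v → ∃ λ a → a ∈ f u × a ∈ f v)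
                    × ((∃ λ a → a ∈ f u × a ∈ f v) → Adj G u v))

DuallyChordal : Graph → Set₁
DuallyChordal G = Σ Graph λ H → Chordal H × IsCliqueGraphOf G H

-- Let G be the clique graph of a chordal graph H, let v_i, v_k be projections of x onto a
-- shortest path with d(v_i, v_k) ≥ 3, both at distance r from x, and suppose every path vertex
-- strictly between them is farther than r from x. For r ≤ 1 the walks through x already give
-- d(v_i, v_k) ≤ 2, so let r = s + 2. Consecutive cliques on the path meet, so the segment from
-- v_i to v_k yields an H-chain from a ∈ v_i to b ∈ v_k whose inner vertices lie in no clique
-- within distance s + 1 of x; the walks from v_k and v_i down to x yield a chain back from b to
-- a whose inner vertices lie in cliques within distance s of x. Every edge of H lies in a
-- maximal clique, i.e. a vertex of G, so no vertex of the first chain equals or is adjacent to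
-- one of the second, and a, b are neither equal nor adjacent. Shortening the two chains as far
-- as possible leaves a chordless cycle of length at least four in H.

module Submission where

open import Defs

open import Data.Empty using (⊥; ⊥-elim)
open import Data.Fin using (Fin; toℕ; zero; suc)
open import Data.Fin.Properties using (toℕ-injective; toℕ<n; toℕ-fromℕ<; any?) renaming (_≟_ to _≟ᶠ_)
open import Data.Fin.Subset using (Subset; _∈_; _⊆_; _∪_; ⁅_⁆)
open import Data.Fin.Subset.Properties using (x∈⁅x⁆; x∈⁅y⁆⇒x≡y; p⊆p∪q; q⊆p∪q; x∈p∪q⁻; _∈?_)
open import Data.List using (List; []; _∷_; _++_; length; lookup; reverse; allFin)
open import Data.List.Properties using (∷-injective; length-++-≤ʳ; unfold-reverse)
open import Data.List.Membership.Propositional using () renaming (_∈_ to _∈ˡ_)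
open import Data.List.Membership.Propositional.Properties using (∈-allFin)
open import Data.List.Relation.Unary.Any using (here; there)
open import Data.List.Relation.Unary.All using (All; []; _∷_)
import Data.List.Relation.Unary.All as All using (map; head)
import Data.List.Relation.Unary.All.Properties as Allₚ
open import Data.Nat using (ℕ; zero; suc; _+_; _∸_; _≤_; _<_; z≤n; s≤s; s≤s⁻¹)
open import Data.Nat.DivMod using (_mod_; m<n⇒m%n≡m)
open import Data.Nat.Induction using (<-wellFounded)
open import Data.Nat.Properties
open import Data.Product using (∃; ∃₂; _×_; _,_; proj₁; proj₂)
import Data.Product as Product
open import Data.Sum using (_⊎_; inj₁; inj₂)
open import Function using (_∘_; _$_; case_of_)
open import Induction.WellFounded using (Acc; acc)
open import Relation.Binary.Construct.Closure.Reflexive using (ReflClosure; refl; [_])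
import Relation.Binary.Construct.Closure.Reflexive.Properties as ReflClosure
open import Relation.Binary.Definitions using (tri<; tri≈; tri>)
open import Relation.Binary.PropositionalEquality using (_≡_; _≢_; refl; cong; subst; subst₂)
  renaming (sym to ≡-sym; trans to ≡-trans)
open import Relation.Nullary using (¬_; Dec; yes; no)
open import Relation.Nullary.Decidable using (_×-dec_; map′; ¬¬-excluded-middle)
open import Relation.Unary using (Decidable)

least-witness : {P : ℕ → Set} → Decidable P → ∀ m → P m → ∃ λ k → P k × (∀ m′ → P m′ → k ≤ m′)
least-witness P? zero p = zero , p , λ _ _ → z≤n
least-witness {P} P? (suc m) p with P? zero
... | yes p₀ = zero , p₀ , λ _ _ → z≤n
... | no ¬p₀ with least-witness (λ t → P? (suc t)) m p
...   | k , pk , least = suc k , pk , lower-bound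
  where
  lower-bound : ∀ m′ → P m′ → suc k ≤ m′
  lower-bound zero p′ = ⊥-elim (¬p₀ p′)
  lower-bound (suc m′) p′ = s≤s (least m′ p′)

Within : (G : Graph) → Fin (n G) → Fin (n G) → ℕ → Set
Within G u v r = ∃ λ m → m ≤ r × Walk G u v m

IsPath : (G : Graph) → (ℕ → Fin (n G)) → ℕ → Set
IsPath G g m = ∀ t → t < m → Adj G (g t) (g (suc t))

module _ {G : Graph} where

  walk-++ : ∀ {u v w m m'} → Walk G u v m → Walk G v w m' → Walk G u w (m + m')
  walk-++ nil W' = W'
  walk-++ (cons e W) W' = cons e (walk-++ W W')

  walk-reverse : ∀ {u v m} → Walk G u v m → Walk G v u m
  walk-reverse nil = nil
  walk-reverse {m = suc m} (cons e W) = subst (Walk G _ _) (+-comm m 1) (walk-++ (walk-reverse W) (cons (sym G e) nil))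

  path-walk : ∀ (g : ℕ → Fin (n G)) m → IsPath G g m → Walk G (g 0) (g m) m
  path-walk g zero _ = nil
  path-walk g (suc m) adj = cons (adj 0 (s≤s z≤n)) (path-walk (g ∘ suc) m λ t t<m → adj (suc t) (s≤s t<m))

  far-path-length : ∀ (g : ℕ → Fin (n G)) m {k} → IsPath G g m → ¬ Within G (g 0) (g m) k → k < m
  far-path-length g m adj far = ≰⇒> λ m≤k → far (m , m≤k , path-walk g m adj)

  within-++ : ∀ {u v w r s} → Within G u v r → Within G v w s → Within G u w (r + s)
  within-++ (m , m≤r , W) (m' , m'≤s , W') = m + m' , +-mono-≤ m≤r m'≤s , walk-++ W W'

  module _ (adj? : ∀ u v → Dec (Adj G u v)) where

    walk? : ∀ u v m → Dec (Walk G u v m)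
    walk? u v zero with u ≟ᶠ v
    ... | yes refl = yes nil
    ... | no u≢v = no λ { nil → u≢v refl }
    walk? u v (suc m) = map′ (λ (w , e , W) → cons e W) (λ { (cons e W) → _ , e , W })
                             (any? λ w → adj? u w ×-dec walk? w v m)

    within? : ∀ u v r → Dec (Within G u v r)
    within? u v r = map′ (λ (m , m<1+r , W) → m , s≤s⁻¹ m<1+r , W) (λ (m , m≤r , W) → m , s≤s m≤r , W)
                         (anyUpTo? (walk? u v) (suc r))

    within⇒distance : ∀ {u v r} → Within G u v r → ∃ λ k → IsDist G u v k × k ≤ r
    within⇒distance {u} {v} (m , m≤r , W) with least-witness (walk? u v) m W
    ... | k , Wₖ , least = k , (Wₖ , least) , ≤-trans (least m W) m≤r

module _ {A : Set} where

  compare-splits : ∀ {u b : A} xs rest os is → xs ++ u ∷ rest ≡ os ++ b ∷ is →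
      (∃ λ mid → os ≡ xs ++ u ∷ mid × rest ≡ mid ++ b ∷ is)
    ⊎ (xs ≡ os × u ≡ b × rest ≡ is)
    ⊎ (∃ λ mid → xs ≡ os ++ b ∷ mid × is ≡ mid ++ u ∷ rest)
  compare-splits [] rest [] is refl = inj₂ (inj₁ (refl , refl , refl))
  compare-splits [] rest (o ∷ os) is eq with ∷-injective eq
  ... | refl , eq′ = inj₁ (os , refl , eq′)
  compare-splits (x ∷ xs) rest [] is eq with ∷-injective eq
  ... | refl , eq′ = inj₂ (inj₂ (xs , refl , ≡-sym eq′))
  compare-splits (x ∷ xs) rest (o ∷ os) is eq with ∷-injective eq
  ... | refl , eq′ with compare-splits xs rest os is eq′
  ... | inj₁ (mid , e₁ , e₂) = inj₁ (mid , cong (x ∷_) e₁ , e₂)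
  ... | inj₂ (inj₁ (e₁ , e₂ , e₃)) = inj₂ (inj₁ (cong (x ∷_) e₁ , e₂ , e₃))
  ... | inj₂ (inj₂ (mid , e₁ , e₂)) = inj₂ (inj₂ (mid , cong (x ∷_) e₁ , e₂))

  split-at : ∀ (L : List A) j → ∃₂ λ zs ws →
    L ≡ zs ++ lookup L j ∷ ws × length zs ≡ toℕ j × length L ≡ suc (toℕ j + length ws)
  split-at (x ∷ L) zero = [] , L , refl , refl , refl
  split-at (x ∷ L) (suc j) with split-at L j
  ... | zs , ws , eq , |zs| , |L| = x ∷ zs , ws , cong (x ∷_) eq , cong suc |zs| , cong suc |L|

  split-at-two : ∀ (L : List A) i j → toℕ i < toℕ j → ∃ λ ys → ∃₂ λ zs ws →
      L ≡ ys ++ lookup L i ∷ zs ++ lookup L j ∷ ws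
    × length ys ≡ toℕ i × toℕ j ≡ suc (length ys + length zs) × length L ≡ suc (toℕ j + length ws)
  split-at-two (x ∷ L) zero (suc j) _ with split-at L j
  ... | zs , ws , eq , |zs| , |L| = [] , zs , ws , cong (x ∷_) eq , refl , cong suc (≡-sym |zs|) , cong suc |L|
  split-at-two (x ∷ L) (suc i) (suc j) (s≤s i<j) with split-at-two L i j i<j
  ... | ys , zs , ws , eq , |ys| , j≡ , |L| =
    x ∷ ys , zs , ws , cong (x ∷_) eq , cong suc |ys| , cong suc j≡ , cong suc |L|

  all-reverse : ∀ {P : A → Set} {xs} → All P xs → All P (reverse xs)
  all-reverse [] = []
  all-reverse {P} {x ∷ xs} (px ∷ pxs) =
    subst (All P) (≡-sym (unfold-reverse x xs)) (Allₚ.∷ʳ⁺ (all-reverse pxs) px)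

  length-<-++-∷ : ∀ ys {u : A} {zs} → length ys < length (ys ++ u ∷ zs)
  length-<-++-∷ [] = s≤s z≤n
  length-<-++-∷ (_ ∷ ys) = s≤s (length-<-++-∷ ys)

  length-++-∷-< : ∀ ys {u : A} {xs xs′} → length xs′ < length xs →
                  length (ys ++ u ∷ xs′) < length (ys ++ u ∷ xs)
  length-++-∷-< [] lt = s≤s lt
  length-++-∷-< (_ ∷ ys) lt = s≤s (length-++-∷-< ys lt)

  module _ (_≟_ : (x y : A) → Dec (x ≡ y)) where
    open import Data.List.Membership.DecPropositional _≟_ using () renaming (_∈?_ to _∈ˡ?_)
    open import Data.List.Membership.Propositional.Properties using (∈-∃++; ∈-lookup)

    duplicate-or-injective : ∀ L →
        (∃ λ ys → ∃ λ u → ∃₂ λ zs ws → L ≡ ys ++ u ∷ zs ++ u ∷ ws)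
      ⊎ (∀ i j → lookup L i ≡ lookup L j → i ≡ j)
    duplicate-or-injective [] = inj₂ λ ()
    duplicate-or-injective (x ∷ L) with x ∈ˡ? L
    ... | yes x∈L with ∈-∃++ x∈L
    ...   | zs , ws , eq = inj₁ ([] , x , zs , ws , cong (x ∷_) eq)
    duplicate-or-injective (x ∷ L) | no x∉L with duplicate-or-injective L
    ... | inj₁ (ys , u , zs , ws , eq) = inj₁ (x ∷ ys , u , zs , ws , cong (x ∷_) eq)
    ... | inj₂ injective = inj₂ injective′
      where
      injective′ : ∀ i j → lookup (x ∷ L) i ≡ lookup (x ∷ L) j → i ≡ j
      injective′ zero zero _ = refl
      injective′ zero (suc j) eq = ⊥-elim (x∉L (subst (_∈ˡ L) (≡-sym eq) (∈-lookup j)))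
      injective′ (suc i) zero eq = ⊥-elim (x∉L (subst (_∈ˡ L) eq (∈-lookup i)))
      injective′ (suc i) (suc j) eq = cong suc (injective i j eq)

module Chains {A : Set} (_∼_ : A → A → Set) where

  infixr 5 _◅_ _◅◅_

  data Chain : A → List A → A → Set where
    [_] : ∀ {a b} → a ∼ b → Chain a [] b
    _◅_ : ∀ {a q qs b} → a ∼ q → Chain q qs b → Chain a (q ∷ qs) b

  chain-split : ∀ xs {ys a u b} → Chain a (xs ++ u ∷ ys) b → Chain a xs u × Chain u ys b
  chain-split [] (r ◅ c) = [ r ] , c
  chain-split (x ∷ xs) (r ◅ c) = Product.map₁ (r ◅_) (chain-split xs c)

  _◅◅_ : ∀ {a xs u ys b} → Chain a xs u → Chain u ys b → Chain a (xs ++ u ∷ ys) b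
  [ r ] ◅◅ c = r ◅ c
  (r ◅ c) ◅◅ c′ = r ◅ (c ◅◅ c′)

  chain-reverse : (∀ {x y} → x ∼ y → y ∼ x) → ∀ {a xs b} → Chain a xs b → Chain b (reverse xs) a
  chain-reverse sym [ r ] = [ sym r ]
  chain-reverse sym {a} {q ∷ qs} {b} (r ◅ c) =
    subst (λ xs → Chain b xs a) (≡-sym (unfold-reverse q qs)) (chain-reverse sym c ◅◅ [ sym r ])

  chain-lookup : ∀ {a xs b} → Chain a xs b → ∀ i j → toℕ j ≡ suc (toℕ i) →
                 lookup (a ∷ xs) i ∼ lookup (a ∷ xs) j
  chain-lookup (r ◅ c) zero (suc zero) _ = r
  chain-lookup (r ◅ c) (suc i) (suc j) eq = chain-lookup c i j (suc-injective eq)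
  chain-lookup [ r ] zero (suc ()) _
  chain-lookup [ r ] (suc ()) _ _
  chain-lookup (r ◅ c) zero zero ()
  chain-lookup (r ◅ c) zero (suc (suc j)) ()
  chain-lookup (r ◅ c) (suc i) zero ()

  chain-last : ∀ {a xs b} → Chain a xs b → ∀ i → suc (toℕ i) ≡ length (a ∷ xs) → lookup (a ∷ xs) i ∼ b
  chain-last [ r ] zero _ = r
  chain-last (r ◅ c) (suc i) eq = chain-last c i (suc-injective eq)
  chain-last (r ◅ c) zero ()

  -- Two positions of the cyclic list L whose vertices are related and which are not cyclically
  -- consecutive unless the vertices coincide, so that cutting out one arc shortens the cycle.
  record Shortcut (L : List A) : Set where
    constructor shortcut
    field
      {ys zs ws} : List A
      {u v} : A
      splits : L ≡ ys ++ u ∷ zs ++ v ∷ ws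
      related : u ∼ v
      skips-between : u ≡ v ⊎ zs ≢ []
      skips-around : u ≡ v ⊎ (ys ≡ [] → ws ≢ [])

  chord-shortcut : ∀ L i j → toℕ i < toℕ j → ¬ CycNext (length L) i j → ¬ CycNext (length L) j i →
                   lookup L i ∼ lookup L j → Shortcut L
  chord-shortcut L i j i<j ¬i→j ¬j→i r with split-at-two L i j i<j
  ... | ys , zs , ws , eq , |ys| , j≡ , |L| = shortcut eq r (inj₂ (zs≢[] zs j≡)) (inj₂ (ws≢[] ys ws |ys| |L|))
    where
    zs≢[] : ∀ zs → toℕ j ≡ suc (length ys + length zs) → zs ≢ []
    zs≢[] [] j≡ refl = ¬i→j (inj₁ (≡-trans j≡ (cong suc (≡-trans (+-identityʳ _) |ys|))))
    ws≢[] : ∀ ys ws → length ys ≡ toℕ i → length L ≡ suc (toℕ j + length ws) → ys ≡ [] → ws ≢ []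
    ws≢[] [] [] |ys| |L| refl refl = ¬j→i (inj₂ (≡-sym (≡-trans |L| (cong suc (+-identityʳ _))) , ≡-sym |ys|))

  module _ {P : A → Set} where

    Shorter : A → List A → A → Set
    Shorter a xs b = ∃ λ xs′ → Chain a xs′ b × length xs′ < length xs × All P xs′

    skip-from-start : ∀ zs {v ws a b} → Chain a (zs ++ v ∷ ws) b → All P (zs ++ v ∷ ws) →
                      a ∼ v → a ≡ v ⊎ zs ≢ [] → Shorter a (zs ++ v ∷ ws) b
    skip-from-start zs {v} {ws} c ps _ (inj₁ refl) with Allₚ.++⁻ʳ zs ps
    ... | _ ∷ pws = ws , proj₂ (chain-split zs c) , length-++-≤ʳ (v ∷ ws) {zs} , pws
    skip-from-start [] c ps _ (inj₂ zs≢[]) = ⊥-elim (zs≢[] refl)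
    skip-from-start (z ∷ zs) {v} {ws} c ps r (inj₂ _) =
      v ∷ ws , r ◅ proj₂ (chain-split (z ∷ zs) c) , s≤s (length-++-≤ʳ (v ∷ ws) {zs}) , Allₚ.++⁻ʳ (z ∷ zs) ps

    skip-inner : ∀ ys {u} zs {v ws a b} → Chain a (ys ++ u ∷ zs ++ v ∷ ws) b → All P (ys ++ u ∷ zs ++ v ∷ ws) →
                 u ∼ v → u ≡ v ⊎ zs ≢ [] → Shorter a (ys ++ u ∷ zs ++ v ∷ ws) b
    skip-inner ys {u} zs c ps r shrinks with chain-split ys c | Allₚ.++⁻ ys ps
    ... | c₁ , c₂ | pys , pu ∷ prest with skip-from-start zs c₂ prest r shrinks
    ... | xs′ , c₂′ , shorter , pxs′ =
      ys ++ u ∷ xs′ , c₁ ◅◅ c₂′ , length-++-∷-< ys shorter , Allₚ.++⁺ pys (pu ∷ pxs′)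

    skip-to-end : ∀ ys {u} zs {a b} → Chain a (ys ++ u ∷ zs) b → All P (ys ++ u ∷ zs) →
                  u ∼ b → u ≡ b ⊎ zs ≢ [] → Shorter a (ys ++ u ∷ zs) b
    skip-to-end ys {u} zs c ps r (inj₁ refl) =
      ys , proj₁ (chain-split ys c) , length-<-++-∷ ys , Allₚ.++⁻ˡ ys ps
    skip-to-end ys [] c ps r (inj₂ zs≢[]) = ⊥-elim (zs≢[] refl)
    skip-to-end ys {u} (z ∷ zs) c ps r (inj₂ _) with Allₚ.++⁻ ys ps
    ... | pys , pu ∷ _ =
      ys ++ u ∷ [] , proj₁ (chain-split ys c) ◅◅ [ r ] , length-++-∷-< ys (s≤s z≤n) , Allₚ.++⁺ pys (pu ∷ [])

module _ {H : Graph} where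

  private
    V = Fin (n H)
    _∼_ = ReflClosure (Adj H)

  open Chains _∼_

  ∼-sym : ∀ {u v} → u ∼ v → v ∼ u
  ∼-sym = ReflClosure.sym (sym H)

  ∼⇒Adj : ∀ {u v} → u ∼ v → u ≢ v → Adj H u v
  ∼⇒Adj [ e ] _ = e
  ∼⇒Adj refl u≢u = ⊥-elim (u≢u refl)

  closed-chain-cycle : ∀ {a xs} → Chain a xs a → 1 ≤ length xs →
                       (∀ i j → lookup (a ∷ xs) i ≡ lookup (a ∷ xs) j → i ≡ j) →
                       IsCycle H (length (a ∷ xs)) (lookup (a ∷ xs))
  closed-chain-cycle {a} {xs} c 1≤|xs| injective = injective , adjacent
    where
    adjacent : ∀ i j → CycNext (length (a ∷ xs)) i j → Adj H (lookup (a ∷ xs) i) (lookup (a ∷ xs) j)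
    adjacent i j (inj₁ j≡1+i) = ∼⇒Adj (chain-lookup c i j j≡1+i) λ eq →
      1+n≢n (≡-sym (≡-trans (cong toℕ (injective i j eq)) j≡1+i))
    adjacent i zero (inj₂ (1+i≡len , _)) = ∼⇒Adj (chain-last c i 1+i≡len) λ eq →
      <⇒≢ 1≤|xs| (≡-sym (suc-injective (≡-trans (≡-sym 1+i≡len) (cong (suc ∘ toℕ) (injective i zero eq)))))

  closed-chain-shortcut : Chordal H → ∀ {a xs} → Chain a xs a → 3 ≤ length xs → Shortcut (a ∷ xs)
  closed-chain-shortcut chordal {a} {xs} c 3≤|xs| with duplicate-or-injective _≟ᶠ_ (a ∷ xs)
  ... | inj₁ (_ , _ , _ , _ , eq) = shortcut eq refl (inj₁ refl) (inj₁ refl)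
  ... | inj₂ injective
    with chordal (length (a ∷ xs)) (s≤s 3≤|xs|) (lookup (a ∷ xs))
                 (closed-chain-cycle c (≤-trans (s≤s z≤n) 3≤|xs|) injective)
  ... | i , j , i≢j , ¬i→j , ¬j→i , e with <-cmp (toℕ i) (toℕ j)
  ...   | tri< i<j _ _ = chord-shortcut (a ∷ xs) i j i<j ¬i→j ¬j→i [ e ]
  ...   | tri≈ _ i≡j _ = ⊥-elim (i≢j (toℕ-injective i≡j))
  ...   | tri> _ _ j<i = chord-shortcut (a ∷ xs) j i j<i ¬j→i ¬i→j [ sym H e ]

  module _ {Pₒ Pᵢ : V → Set} {a b : V} where

    record SeparatedCycle : Set where
      constructor separated-cycle
      field
        {os is} : List V
        outer : Chain a os b
        inner : Chain b is a
        outer-side : All Pₒ os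
        inner-side : All Pᵢ is

    size : SeparatedCycle → ℕ
    size C = length (SeparatedCycle.os C) + length (SeparatedCycle.is C)

    private
      shorter-outer : ∀ {os is} → Shorter {Pₒ} a os b → Chain b is a → All Pᵢ is →
                      ∃ λ C → size C < length os + length is
      shorter-outer {is = is} (_ , co , lt , po) ci pi = separated-cycle co ci po pi , +-monoˡ-< (length is) lt

      shorter-inner : ∀ {os is} → Chain a os b → All Pₒ os → Shorter {Pᵢ} b is a →
                      ∃ λ C → size C < length os + length is
      shorter-inner {os} co po (_ , ci , lt , pi) = separated-cycle co ci po pi , +-monoʳ-< (length os) lt

    module _ (separated : ∀ {u v} → Pₒ u → Pᵢ v → ¬ u ∼ v) (apart : ¬ a ∼ b) where

      -- A shortcut within one side (a and b included) shortens that side; one joining the two sides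
      -- is excluded by separated and apart.
      shrink : ∀ {os is} → Chain a os b → Chain b is a → All Pₒ os → All Pᵢ is →
               Shortcut (a ∷ os ++ b ∷ is) → ∃ λ C → size C < length os + length is
      shrink {os} {is} co ci po pi (shortcut {[]} {zs} {ws} eq r between around) with ∷-injective eq
      ... | refl , eq′ with compare-splits zs ws os is (≡-sym eq′)
      ... | inj₁ (_ , refl , _) = shorter-outer {os} (skip-from-start zs co po r between) ci pi
      ... | inj₂ (inj₁ (_ , refl , _)) = ⊥-elim (apart r)
      ... | inj₂ (inj₂ (mid , _ , refl)) = shorter-inner {is = is} co po (skip-to-end mid ws ci pi (∼-sym r) (wrap around))
        where
        wrap : ∀ {v} → a ≡ v ⊎ ([] ≡ [] → ws ≢ []) → v ≡ a ⊎ ws ≢ []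
        wrap (inj₁ a≡v) = inj₁ (≡-sym a≡v)
        wrap (inj₂ ws≢[]) = inj₂ (ws≢[] refl)
      shrink {os} {is} co ci po pi (shortcut {_ ∷ ys} {zs} {ws} eq r between around) with ∷-injective eq
      ... | refl , eq′ with compare-splits ys (zs ++ _ ∷ ws) os is (≡-sym eq′)
      ... | inj₁ (mid , refl , eq″) with compare-splits zs ws mid is eq″
      ...   | inj₁ (_ , refl , _) = shorter-outer {os} (skip-inner ys zs co po r between) ci pi
      ...   | inj₂ (inj₁ (refl , refl , refl)) = shorter-outer {os} (skip-to-end ys zs co po r between) ci pi
      ...   | inj₂ (inj₂ (mid′ , _ , refl)) =
        ⊥-elim (separated (All.head (Allₚ.++⁻ʳ ys po)) (All.head (Allₚ.++⁻ʳ mid′ pi)) r)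
      shrink {os} {is} co ci po pi (shortcut {_ ∷ ys} {zs} {ws} eq r between around)
        | refl , eq′ | inj₂ (inj₁ (refl , refl , refl)) = shorter-inner {is = is} co po (skip-from-start zs ci pi r between)
      shrink {os} {is} co ci po pi (shortcut {_ ∷ ys} {zs} {ws} eq r between around)
        | refl , eq′ | inj₂ (inj₂ (mid , refl , refl)) = shorter-inner {is = is} co po (skip-inner mid zs ci pi r between)

    no-separated-cycle : Chordal H → (∀ {u v} → Pₒ u → Pᵢ v → ¬ u ∼ v) → ¬ a ∼ b →
                         ∀ {os is} → Chain a os b → Chain b is a → All Pₒ os → All Pᵢ is → ⊥
    no-separated-cycle chordal separated apart co ci po pi = go (separated-cycle co ci po pi) (<-wellFounded _)
      where
      3≤length : ∀ o os {b i is} → 3 ≤ length ((o ∷ os) ++ b ∷ i ∷ is)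
      3≤length _ os {b} {i} {is} = s≤s (≤-trans (s≤s (s≤s z≤n)) (length-++-≤ʳ (b ∷ i ∷ is) {os}))

      go : (C : SeparatedCycle) → Acc _<_ (size C) → ⊥
      go (separated-cycle [ r ] _ _ _) _ = apart r
      go (separated-cycle _ [ r ] _ _) _ = apart (∼-sym r)
      go (separated-cycle {o ∷ os} co@(_ ◅ _) ci@(_ ◅ _) po pi) (acc smaller)
        with shrink separated apart co ci po pi (closed-chain-shortcut chordal (co ◅◅ ci) (3≤length o os))
      ... | C , lt = go C (smaller lt)

AdjacentToAll : (H : Graph) → Subset (n H) → Fin (n H) → Set
AdjacentToAll H C v = ∀ c → c ∈ C → c ≢ v → Adj H c v

module _ {H : Graph} where

  singleton-clique : ∀ a → IsClique H ⁅ a ⁆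
  singleton-clique a x y x∈ y∈ x≢y with x∈⁅y⁆⇒x≡y a x∈ | x∈⁅y⁆⇒x≡y a y∈
  ... | refl | refl = ⊥-elim (x≢y refl)

  clique-∪-⁅⁆ : ∀ {C v} → IsClique H C → AdjacentToAll H C v → IsClique H (C ∪ ⁅ v ⁆)
  clique-∪-⁅⁆ {C} {v} cl v~C x y x∈ y∈ x≢y with x∈p∪q⁻ C ⁅ v ⁆ x∈ | x∈p∪q⁻ C ⁅ v ⁆ y∈
  ... | inj₁ x∈C | inj₁ y∈C = cl x y x∈C y∈C x≢y
  ... | inj₁ x∈C | inj₂ y∈v rewrite x∈⁅y⁆⇒x≡y v y∈v = v~C x x∈C x≢y
  ... | inj₂ x∈v | inj₁ y∈C rewrite x∈⁅y⁆⇒x≡y v x∈v = sym H (v~C y y∈C (x≢y ∘ ≡-sym))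
  ... | inj₂ x∈v | inj₂ y∈v = singleton-clique v x y x∈v y∈v x≢y

  edge-clique : ∀ {a b} → Adj H a b → IsClique H (⁅ a ⁆ ∪ ⁅ b ⁆)
  edge-clique {a} {b} e = clique-∪-⁅⁆ (singleton-clique a) λ c c∈a _ →
    subst (λ c → Adj H c b) (≡-sym (x∈⁅y⁆⇒x≡y a c∈a)) e

  saturate-clique : ∀ {C} → IsClique H C → ∀ vs →
    ¬ ¬ (∃ λ C′ → IsClique H C′ × C ⊆ C′ × (∀ v → v ∈ˡ vs → AdjacentToAll H C′ v → v ∈ C′))
  saturate-clique cl [] k = k (_ , cl , (λ x∈ → x∈) , λ _ ())
  saturate-clique {C} cl (v ∷ vs) k = ¬¬-excluded-middle λ where
    (yes v~C) → saturate-clique (clique-∪-⁅⁆ cl v~C) vs λ (C′ , cl′ , C∪v⊆C′ , saturated) →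
      k (C′ , cl′ , (λ x∈C → C∪v⊆C′ (p⊆p∪q ⁅ v ⁆ x∈C)) , λ where
        _ (here refl) _ → C∪v⊆C′ (q⊆p∪q C ⁅ v ⁆ (x∈⁅x⁆ v))
        w (there w∈vs) → saturated w w∈vs)
    (no ¬v~C) → saturate-clique cl vs λ (C′ , cl′ , C⊆C′ , saturated) →
      k (C′ , cl′ , C⊆C′ , λ where
        _ (here refl) v~C′ → ⊥-elim (¬v~C λ c c∈C → v~C′ c (C⊆C′ c∈C))
        w (there w∈vs) → saturated w w∈vs)

  extend-to-maximal-clique : ∀ {C} → IsClique H C → ¬ ¬ (∃ λ C′ → IsMaximalClique H C′ × C ⊆ C′)
  extend-to-maximal-clique cl k = saturate-clique cl (allFin _) λ (C′ , cl′ , C⊆C′ , saturated) →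
    k (C′ , (cl′ , λ D clD C′⊆D {w} w∈D → saturated w (∈-allFin w) λ c c∈C′ → clD c w (C′⊆D c∈C′) w∈D)
       , C⊆C′)

  edge-in-maximal-clique : ∀ {a b} → Adj H a b → ¬ ¬ (∃ λ C → IsMaximalClique H C × a ∈ C × b ∈ C)
  edge-in-maximal-clique {a} {b} e k = extend-to-maximal-clique (edge-clique e) λ (C , maxC , ab⊆C) →
    k (C , maxC , ab⊆C (p⊆p∪q ⁅ b ⁆ (x∈⁅x⁆ a)) , ab⊆C (q⊆p∪q ⁅ a ⁆ ⁅ b ⁆ (x∈⁅x⁆ b)))

  maximal-clique-nonempty : Fin (n H) → ∀ {C} → IsMaximalClique H C → ∃ λ c → c ∈ C
  maximal-clique-nonempty a {C} (_ , maximal) with any? (_∈? C)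
  ... | yes c∈C = c∈C
  ... | no ∄c∈C =
    ⊥-elim (∄c∈C (a , maximal ⁅ a ⁆ (singleton-clique a) (λ {c} c∈C → ⊥-elim (∄c∈C (c , c∈C))) (x∈⁅x⁆ a)))

module CliqueGraph {G H : Graph} (f : Fin (n G) → Subset (n H))
  (maximal : ∀ u → IsMaximalClique H (f u))
  (onto : ∀ C → IsMaximalClique H C → ∃ λ u → f u ≡ C)
  (adjacency : ∀ u v → u ≢ v → (Adj G u v → ∃ λ a → a ∈ f u × a ∈ f v)
                               × ((∃ λ a → a ∈ f u × a ∈ f v) → Adj G u v))
  where

  private
    U = Fin (n G)
    V = Fin (n H)
    _∼_ = ReflClosure (Adj H)

  open Chains _∼_

  shared-vertex : ∀ {u v} → Adj G u v → ∃ λ a → a ∈ f u × a ∈ f v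
  shared-vertex {u} {v} e = proj₁ (adjacency u v λ { refl → irrefl G e }) e

  shared⇒within-1 : ∀ {a u v} → a ∈ f u → a ∈ f v → Within G u v 1
  shared⇒within-1 {a} {u} {v} a∈u a∈v with u ≟ᶠ v
  ... | yes refl = 0 , z≤n , nil
  ... | no u≢v = 1 , ≤-refl , cons (proj₂ (adjacency u v u≢v) (a , a∈u , a∈v)) nil

  adj? : ∀ u v → Dec (Adj G u v)
  adj? u v with u ≟ᶠ v
  ... | yes refl = no (irrefl G)
  ... | no u≢v = map′ (proj₂ (adjacency u v u≢v)) (proj₁ (adjacency u v u≢v))
                      (any? λ a → a ∈? f u ×-dec a ∈? f v)

  same-clique : ∀ {a c u} → a ∈ f u → c ∈ f u → a ∼ c
  same-clique {a} {c} {u} a∈u c∈u with a ≟ᶠ c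
  ... | yes refl = refl
  ... | no a≢c = [ proj₁ (maximal u) a c a∈u c∈u a≢c ]

  ∼⇒near-clique : ∀ {a b u} → a ∼ b → b ∈ f u → ¬ ¬ (∃ λ w → a ∈ f w × Within G w u 1)
  ∼⇒near-clique {u = u} refl b∈u k = k (u , b∈u , 0 , z≤n , nil)
  ∼⇒near-clique {a} {b} [ e ] b∈u k = edge-in-maximal-clique {H} e λ (C , maxC , a∈C , b∈C) →
    let (w , w≡C) = onto C maxC
    in k (w , subst (a ∈_) (≡-sym w≡C) a∈C , shared⇒within-1 (subst (b ∈_) (≡-sym w≡C) b∈C) b∈u)

  Near : U → ℕ → V → Set
  Near x r a = ∃ λ w → a ∈ f w × Within G w x r

  far⇒unrelated : ∀ {u w a b} → ¬ Within G u w 2 → a ∈ f u → b ∈ f w → ¬ a ∼ b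
  far⇒unrelated far a∈u b∈w a∼b = ∼⇒near-clique a∼b b∈w λ (v , a∈v , v→w) →
    far (within-++ (shared⇒within-1 a∈u a∈v) v→w)

  near⇒unrelated : ∀ {x s a b} → ¬ Near x (suc s) a → Near x s b → ¬ a ∼ b
  near⇒unrelated ¬near (E , b∈E , E→x) a∼b = ∼⇒near-clique a∼b b∈E λ (w , a∈w , w→E) →
    ¬near (w , a∈w , within-++ w→E E→x)

  path-chain : ∀ (g : ℕ → U) m → IsPath G g m → ∀ {a c} → a ∈ f (g 0) → c ∈ f (g m) →
               ∃ λ qs → Chain a qs c × All (λ q → ∃ λ t → t < m × q ∈ f (g t) × q ∈ f (g (suc t))) qs
  path-chain g zero _ a∈ c∈ = [] , [ same-clique a∈ c∈ ] , []
  path-chain g (suc m) adj a∈ c∈ with shared-vertex (adj 0 (s≤s z≤n))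
  ... | q , q∈g₀ , q∈g₁ with path-chain (g ∘ suc) m (λ t t<m → adj (suc t) (s≤s t<m)) q∈g₁ c∈
  ... | qs , chain , pqs = q ∷ qs , same-clique a∈ q∈g₀ ◅ chain ,
    (0 , s≤s z≤n , q∈g₀ , q∈g₁) ∷ All.map (λ (t , t<m , q∈) → suc t , s≤s t<m , q∈) pqs

  walk-chain : ∀ {u v m s} → Walk G u v m → m ≤ suc s → ∀ {a c} → a ∈ f u → c ∈ f v →
               ∃ λ qs → Chain a qs c × All (Near v s) qs
  walk-chain nil _ a∈ c∈ = [] , [ same-clique a∈ c∈ ] , []
  walk-chain {s = s} (cons e W) (s≤s m≤s) a∈ c∈ with shared-vertex e
  ... | q , q∈u , q∈w with walk-chain W (≤-trans m≤s (n≤1+n s)) q∈w c∈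
  ... | qs , chain , pqs = q ∷ qs , same-clique a∈ q∈u ◅ chain , (_ , q∈w , _ , m≤s , W) ∷ pqs

  near-chain : ∀ {x s E₀ E₁ a b} → Walk G E₀ x (suc s) → Walk G E₁ x (suc s) → a ∈ f E₀ → b ∈ f E₁ →
               ∃ λ qs → Chain b qs a × All (Near x s) qs
  near-chain {x} {s} {a = a} W₀ W₁ a∈E₀ b∈E₁ with maximal-clique-nonempty {H} a (maximal x)
  ... | c , c∈x with walk-chain {s = s} W₀ ≤-refl a∈E₀ c∈x | walk-chain {s = s} W₁ ≤-refl b∈E₁ c∈x
  ... | qs₀ , chain₀ , near₀ | qs₁ , chain₁ , near₁ =
    qs₁ ++ c ∷ reverse qs₀ , chain₁ ◅◅ chain-reverse (ReflClosure.sym (sym H)) chain₀ ,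
    Allₚ.++⁺ near₁ ((x , c∈x , 0 , z≤n , nil) ∷ all-reverse near₀)

  far-chain : ∀ {x s} (g : ℕ → U) m → IsPath G g m → 2 ≤ m →
              (∀ t → 0 < t → t < m → ¬ Within G (g t) x (suc (suc s))) →
              ∀ {a b} → a ∈ f (g 0) → b ∈ f (g m) →
              ∃ λ qs → Chain a qs b × All (λ q → ¬ Near x (suc s) q) qs
  far-chain {x} {s} g m adj 2≤m outside a∈ b∈ with path-chain g m adj a∈ b∈
  ... | qs , chain , on-path = qs , chain , All.map far on-path
    where
    far : ∀ {q} → (∃ λ t → t < m × q ∈ f (g t) × q ∈ f (g (suc t))) → ¬ Near x (suc s) q
    far (0 , _ , _ , q∈g₁) (w , q∈w , w→x) =
      outside 1 (s≤s z≤n) 2≤m (within-++ (shared⇒within-1 q∈g₁ q∈w) w→x)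
    far (suc t , t<m , q∈gₜ , _) (w , q∈w , w→x) =
      outside (suc t) (s≤s z≤n) t<m (within-++ (shared⇒within-1 q∈gₜ q∈w) w→x)

  path-meets-disk : Chordal H → ∀ {x r} (g : ℕ → U) m → IsPath G g m →
                    ¬ Within G (g 0) (g m) 2 → Walk G (g 0) x r → Walk G (g m) x r →
                    ¬ (∀ t → 0 < t → t < m → ¬ Within G (g t) x r)
  path-meets-disk _ {r = 0} g m _ far W₀ Wₘ _ = far (0 , z≤n , walk-++ W₀ (walk-reverse Wₘ))
  path-meets-disk _ {r = 1} g m _ far W₀ Wₘ _ = far (2 , ≤-refl , walk-++ W₀ (walk-reverse Wₘ))
  path-meets-disk chordal {x} {suc (suc s)} g m adj far (cons e₀ W₀) (cons eₘ Wₘ) outside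
    with shared-vertex e₀ | shared-vertex eₘ
  ... | a , a∈g₀ , a∈E₀ | b , b∈gₘ , b∈Eₘ
    with far-chain g m adj (<⇒≤ (far-path-length g m adj far)) outside a∈g₀ b∈gₘ
       | near-chain W₀ Wₘ a∈E₀ b∈Eₘ
  ... | _ , outer , far-side | _ , inner , near-side =
    no-separated-cycle {H} chordal (near⇒unrelated {x} {s}) (far⇒unrelated far a∈g₀ b∈gₘ)
                       outer inner far-side near-side

module Segment {G : Graph} {l} (P : Fin (suc l) → Fin (n G)) (i k : Fin (suc l)) (i<k : toℕ i < toℕ k) where

  span : ℕ
  span = toℕ k ∸ toℕ i

  -- Reducing mod (l + 1) only makes the index total; it is the identity for t ≤ span.
  index : ℕ → Fin (suc l)
  index t = (t + toℕ i) mod suc l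

  vertex : ℕ → Fin (n G)
  vertex t = P (index t)

  private
    toℕ-mod : ∀ {t} → t ≤ l → toℕ (t mod suc l) ≡ t
    toℕ-mod t≤l = ≡-trans (toℕ-fromℕ< _) (m<n⇒m%n≡m (s≤s t≤l))

    mod-toℕ : ∀ j → toℕ j mod suc l ≡ j
    mod-toℕ j = toℕ-injective (toℕ-mod (s≤s⁻¹ (toℕ<n j)))

    span+i≡k : span + toℕ i ≡ toℕ k
    span+i≡k = m∸n+n≡m (<⇒≤ i<k)

    toℕ-index : ∀ {t} → t ≤ span → toℕ (index t) ≡ t + toℕ i
    toℕ-index t≤span =
      toℕ-mod (≤-trans (+-monoˡ-≤ (toℕ i) t≤span) (≤-trans (≤-reflexive span+i≡k) (s≤s⁻¹ (toℕ<n k))))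

  start : vertex 0 ≡ P i
  start = cong P (mod-toℕ i)

  end : vertex span ≡ P k
  end = cong P (≡-trans (cong (_mod suc l) span+i≡k) (mod-toℕ k))

  adjacent : (∀ (j j′ : Fin (suc l)) → toℕ j′ ≡ suc (toℕ j) → Adj G (P j) (P j′)) → IsPath G vertex span
  adjacent adj t t<span =
    adj (index t) (index (suc t)) (≡-trans (toℕ-index t<span) (cong suc (≡-sym (toℕ-index (<⇒≤ t<span)))))

  interior : ∀ {t} → 0 < t → t < span → toℕ i < toℕ (index t) × toℕ (index t) < toℕ k
  interior {t} 0<t t<span rewrite toℕ-index (<⇒≤ t<span) =
    m<n+m (toℕ i) 0<t , subst (t + toℕ i <_) span+i≡k (+-monoˡ-< (toℕ i) t<span)

lemma13 : (G : Graph) → Connected G → DuallyChordal G → HasProjectionGapAtMost G 1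
lemma13 G _ (H , chordal , f , maximal , _ , onto , adjacency) l P (adj , _) x i k i<k
        (r , dᵢ , minᵢ) (rₖ , dₖ , minₖ) d dᵢₖ 2<d =
  case any? (λ j → toℕ i <? toℕ j ×-dec toℕ j <? toℕ k ×-dec within? adj? (P j) x r) of λ where
    (yes (j , i<j , j<k , near)) →
      let r′ , dⱼ , r′≤r = within⇒distance adj? near
      in j , i<j , j<k , r′ , dⱼ , λ j′ r″ d′ → ≤-trans r′≤r (minᵢ j′ r″ d′)
    (no none) → ⊥-elim $ path-meets-disk chordal vertex span (adjacent adj) far W₀ Wₘ λ t 0<t t<span near →
      none (index t , Product.map₂ (_, near) (interior 0<t t<span))
  where
  open CliqueGraph {G} {H} f maximal onto adjacency
  open Segment {G} P i k i<k
  far : ¬ Within G (vertex 0) (vertex span) 2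
  far (w , w≤2 , W) = <⇒≱ 2<d (≤-trans (proj₂ dᵢₖ w (subst₂ (λ u v → Walk G u v w) start end W)) w≤2)
  W₀ : Walk G (vertex 0) x r
  W₀ = subst (λ u → Walk G u x r) (≡-sym start) (proj₁ dᵢ)
  Wₘ : Walk G (vertex span) x r
  Wₘ = subst₂ (λ u m → Walk G u x m) (≡-sym end) (≤-antisym (minₖ i r dᵢ) (minᵢ k rₖ dₖ)) (proj₁ dₖ)
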